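{- For every finite poset $P$ and every $n$, $$Tr(n,P)\le \min\{m:\ \exists k\ (n,m)\rightarrow(k,La(k,P)+1)\}-1.$$
   Context: The sets $F_1,\dots,F_{|P|}$ form a copy of a poset $P$ if there is a bijection $i:P\to\{F_1,\dots,F_{|P|}\}$ such that $p<_P p'$ implies $i(p)\subsetneq i(p')$; a family is $P$-free if it contains no copy of $P$. $La(n,P)$ is the maximum size of a $P$-free family $\mathcal F\subseteq 2^{[n]}$. For $X$ a set and $\mathcal F$ a family, $\mathcal F|_X=\{F\cap X:F\in\mathcal F\}$. A family $\mathcal F\subseteq 2^{[n]}$ is trace $P$-free if $\mathcal F|_L$ is $P$-free for every $L\subseteq[n]$, and $Tr(n,P)$ is the maximum size of a trace $P$-free family in $2^{[n]}$. The arrow relation $(n,m)\rightarrow(k,l)$ means: for every family $\mathcal F\subseteq 2^{[n]}$ with $|\mathcal F|=m$ there is a $k$-element set $X\subseteq[n]$ with $|\mathcal F|_X|\ge l$. -}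

module Defs where

open import Data.Nat using (ℕ; suc; _≤_)
open import Data.Fin using (Fin)
open import Data.Fin.Subset using (Subset; _⊂_; _∩_; ∣_∣)
open import Data.List using (List; length)
open import Data.List.Relation.Unary.All using (All)
open import Data.List.Relation.Unary.Unique.Propositional using (Unique)
open import Data.List.Membership.Propositional using (_∈_)
open import Data.Product using (Σ; ∃; _×_)
open import Relation.Binary.PropositionalEquality using (_≡_; _≢_)
open import Relation.Nullary using (¬_)
open import Function.Definitions using (Injective)

-- A finite poset P is given by a carrier Fin p and a (non-strict) order _≼_
-- that is a partial order w.r.t. _≡_ (see Statement). Its strict part:
Strict : ∀ {p} → (Fin p → Fin p → Set) → Fin p → Fin p → Set
Strict _≼_ a b = a ≼ b × a ≢ b

-- A (set-)family of subsets of [n] is a predicate on Subset n.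
-- A copy of P in the family A: an injective map i : P → A (so a bijection
-- onto |P| distinct members) with a <_P b ⇒ i a ⊊ i b.
CopyOf : ∀ {p n} → (Fin p → Fin p → Set) → (Subset n → Set) → Set
CopyOf {p} {n} _≼_ A =
  Σ (Fin p → Subset n) λ i →
    Injective _≡_ _≡_ i × (∀ a → A (i a)) × (∀ a b → Strict _≼_ a b → i a ⊂ i b)

PFree : ∀ {p n} → (Fin p → Fin p → Set) → (Subset n → Set) → Set
PFree _≼_ A = ¬ CopyOf _≼_ A

-- A concrete family F ⊆ 2^[n] is a duplicate-free list; |F| = its length.
Member : ∀ {n} → List (Subset n) → Subset n → Set
Member Fs G = G ∈ Fs

Trace : ∀ {n} → List (Subset n) → Subset n → Subset n → Set
Trace Fs X G = ∃ λ F → F ∈ Fs × G ≡ F ∩ X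

AtLeast : ∀ {n} → ℕ → (Subset n → Set) → Set
AtLeast {n} l A = Σ (List (Subset n)) λ Gs → Unique Gs × length Gs ≡ l × All A Gs

TracePFree : ∀ {p n} → (Fin p → Fin p → Set) → List (Subset n) → Set
TracePFree _≼_ Fs = ∀ L → PFree _≼_ (Trace Fs L)

IsLa : ∀ {p} → ℕ → (Fin p → Fin p → Set) → ℕ → Set
IsLa {p} k _≼_ L =
  (Σ (List (Subset k)) λ Fs → Unique Fs × length Fs ≡ L × PFree _≼_ (Member Fs))
  × (∀ (Fs : List (Subset k)) → Unique Fs → PFree _≼_ (Member Fs) → length Fs ≤ L)

Arrow : ℕ → ℕ → ℕ → ℕ → Set
Arrow n m k l =
  ∀ (Fs : List (Subset n)) → Unique Fs → length Fs ≡ m →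
    ∃ λ (X : Subset n) → ∣ X ∣ ≡ k × AtLeast l (Trace Fs X)

-- Let F be trace P-free and suppose |F| ≥ m, where (n,m) → (k, La(k,P)+1).
-- Applying the arrow relation to m members of F gives a k-set X whose trace
-- F|_X has at least La(k,P)+1 members. But F|_X is a P-free family of subsets
-- of X, and 2^X is order-isomorphic to 2^[k]; so F|_X has at most La(k,P)
-- members — a contradiction. Hence |F| ≤ m − 1.
module Submission where

open import Defs
open import Data.Nat using (ℕ; suc; _≤_; _∸_)
open import Data.Fin using (Fin)
open import Data.Fin.Subset using (Subset)
open import Data.List using (List; length)
open import Data.List.Relation.Unary.Unique.Propositional using (Unique)
open import Relation.Binary.PropositionalEquality using (_≡_)
open import Relation.Binary.Structures using (IsPartialOrder)

open import Data.Nat.Properties using (<-irrefl; _≤?_; ≰⇒>; ∸-monoˡ-≤; m≤n⇒m⊓n≡m)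
open import Data.Bool using (true; false)
open import Data.Vec using (_∷_; []; here)
open import Data.Vec.Properties using (∷-injectiveˡ; ∷-injectiveʳ)
open import Data.Fin.Subset using (_⊂_; _⊆_; _∩_; ∣_∣)
open import Data.Fin.Subset.Properties using (drop-∷-⊆; drop-∷-⊂; out⊆; in⊆in; s⊆s; s⊂s; out⊂in)
open import Data.List using (map; take)
open import Data.List.Relation.Unary.All as All using (All)
open import Data.List.Membership.Propositional using (_∈_)
open import Data.List.Membership.Propositional.Properties using (∈-map⁻)
open import Data.List.Relation.Binary.Sublist.Propositional using (lookup)
open import Data.List.Relation.Binary.Sublist.Propositional.Properties using (take-⊆)
open import Data.List.Relation.Unary.Unique.Propositional.Properties using (map⁻; take⁺)
open import Data.List.Properties using (length-take; length-map; map-∘; map-id-local)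
open import Data.Product using (_,_; proj₁)
open import Data.Empty using (⊥-elim)
open import Relation.Nullary using (yes; no)
open import Function using (_∘_; id)
open import Function.Definitions using (Injective)
open import Relation.Binary.PropositionalEquality using (refl; sym; trans; cong; cong₂; subst)

-- Coordinates of a set X ⊆ [n]: 'embed X s' places the bits of s ⊆ [|X|] at
-- the positions of X, and 'compress X' reads off the bits at those positions.
embed : ∀ {n} (X : Subset n) → Subset ∣ X ∣ → Subset n
embed [] s = []
embed (true ∷ X) (b ∷ s) = b ∷ embed X s
embed (false ∷ X) s = false ∷ embed X s

compress : ∀ {n} (X : Subset n) → Subset n → Subset ∣ X ∣
compress [] s = []
compress (true ∷ X) (b ∷ s) = b ∷ compress X s
compress (false ∷ X) (b ∷ s) = compress X s

embed-injective : ∀ {n} (X : Subset n) → Injective _≡_ _≡_ (embed X)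
embed-injective [] {[]} {[]} _ = refl
embed-injective (true ∷ X) {b ∷ s} {c ∷ t} e =
  cong₂ _∷_ (∷-injectiveˡ e) (embed-injective X (∷-injectiveʳ e))
embed-injective (false ∷ X) e = embed-injective X (∷-injectiveʳ e)

embed-⊆ : ∀ {n} (X : Subset n) {s t} → s ⊆ t → embed X s ⊆ embed X t
embed-⊆ [] {[]} {[]} s⊆t = s⊆t
embed-⊆ (true ∷ X) {false ∷ s} {c ∷ t} s⊆t = out⊆ (embed-⊆ X (drop-∷-⊆ s⊆t))
embed-⊆ (true ∷ X) {true ∷ s} {true ∷ t} s⊆t = in⊆in (embed-⊆ X (drop-∷-⊆ s⊆t))
embed-⊆ (true ∷ X) {true ∷ s} {false ∷ t} s⊆t with s⊆t here
... | ()
embed-⊆ (false ∷ X) s⊆t = s⊆s (embed-⊆ X s⊆t)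

embed-⊂ : ∀ {n} (X : Subset n) {s t} → s ⊂ t → embed X s ⊂ embed X t
embed-⊂ [] {[]} {[]} (_ , _ , () , _)
embed-⊂ (true ∷ X) {false ∷ s} {false ∷ t} s⊂t = s⊂s (embed-⊂ X (drop-∷-⊂ s⊂t))
embed-⊂ (true ∷ X) {true ∷ s} {true ∷ t} s⊂t = s⊂s (embed-⊂ X (drop-∷-⊂ s⊂t))
embed-⊂ (true ∷ X) {false ∷ s} {true ∷ t} s⊂t = out⊂in (embed-⊆ X (drop-∷-⊆ (proj₁ s⊂t)))
embed-⊂ (true ∷ X) {true ∷ s} {false ∷ t} s⊂t with proj₁ s⊂t here
... | ()
embed-⊂ (false ∷ X) s⊂t = s⊂s (embed-⊂ X s⊂t)

embed-compress-∩ : ∀ {n} (X F : Subset n) → embed X (compress X (F ∩ X)) ≡ F ∩ X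
embed-compress-∩ [] [] = refl
embed-compress-∩ (true ∷ X) (f ∷ F) = cong (_ ∷_) (embed-compress-∩ X F)
embed-compress-∩ (false ∷ X) (false ∷ F) = cong (false ∷_) (embed-compress-∩ X F)
embed-compress-∩ (false ∷ X) (true ∷ F) = cong (false ∷_) (embed-compress-∩ X F)

embed-compress-trace : ∀ {n} {Fs : List (Subset n)} {X G} →
                       Trace Fs X G → embed X (compress X G) ≡ G
embed-compress-trace {X = X} (F , _ , refl) = embed-compress-∩ X F

PFree-pullback : ∀ {p j n} {_≼_ : Fin p → Fin p → Set}
                 {A : Subset j → Set} {B : Subset n → Set} (f : Subset j → Subset n) →
                 Injective _≡_ _≡_ f → (∀ {s t} → s ⊂ t → f s ⊂ f t) →
                 (∀ {s} → A s → B (f s)) → PFree _≼_ B → PFree _≼_ A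
PFree-pullback f f-inj f-⊂ A⇒B B-free (i , i-inj , i-mem , i-mono) =
  B-free (f ∘ i , i-inj ∘ f-inj , A⇒B ∘ i-mem , λ a b a<b → f-⊂ (i-mono a b a<b))

TracePFree-sub : ∀ {p n} {_≼_ : Fin p → Fin p → Set} {Es Fs : List (Subset n)} →
                 (∀ {F} → F ∈ Es → F ∈ Fs) → TracePFree _≼_ Fs → TracePFree _≼_ Es
TracePFree-sub {Es = Es} {Fs} Es⊆Fs Fs-free X =
  PFree-pullback {A = Trace Es X} {B = Trace Fs X} id id id (λ { (F , F∈ , eq) → F , Es⊆Fs F∈ , eq }) (Fs-free X)

unique-map-retract : ∀ {A B : Set} (g : A → B) (h : B → A) {xs : List A} →
                     All (λ x → h (g x) ≡ x) xs → Unique xs → Unique (map g xs)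
unique-map-retract g h {xs} retract unique-xs = map⁻ (subst Unique (sym hg-xs) unique-xs)
  where
  hg-xs : map h (map g xs) ≡ xs
  hg-xs = trans (sym (map-∘ xs)) (map-id-local retract)

-- Key bound: a duplicate-free list of members of F|_X, for F trace P-free,
-- compresses to a P-free family in 2^[|X|] of the same length, so it has at
-- most La(|X|,P) members.
trace-size-bound : ∀ {p n} (_≼_ : Fin p → Fin p → Set) {Fs : List (Subset n)} (X : Subset n)
                   {L} → IsLa ∣ X ∣ _≼_ L → TracePFree _≼_ Fs →
                   (Gs : List (Subset n)) → Unique Gs → All (Trace Fs X) Gs → length Gs ≤ L
trace-size-bound _≼_ {Fs} X (_ , maximal) Fs-free Gs unique-Gs traces =
  subst (_≤ _) (length-map (compress X) Gs) (maximal Hs unique-Hs Hs-free)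
  where
  Hs : List (Subset ∣ X ∣)
  Hs = map (compress X) Gs

  unique-Hs : Unique Hs
  unique-Hs = unique-map-retract (compress X) (embed X) (All.map embed-compress-trace traces) unique-Gs

  embed-member : ∀ {H} → H ∈ Hs → Trace Fs X (embed X H)
  embed-member H∈ with ∈-map⁻ (compress X) H∈
  ... | G , G∈ , refl = subst (Trace Fs X) (sym (embed-compress-trace G-trace)) G-trace
    where
    G-trace : Trace Fs X G
    G-trace = All.lookup traces G∈

  Hs-free : PFree _≼_ (Member Hs)
  Hs-free = PFree-pullback {A = Member Hs} {B = Trace Fs X} (embed X)
              (embed-injective X) (embed-⊂ X) embed-member (Fs-free X)

-- If |F| ≥ m, the arrow relation applied to the first m members of F yields a
-- k-set X with La(k,P)+1 traces, against 'trace-size-bound'. (The argument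
-- uses no property of the order on P.)
proposition2p2 : (p : ℕ) (_≼_ : Fin p → Fin p → Set) → IsPartialOrder _≡_ _≼_ →
                 (n m k L : ℕ) → IsLa k _≼_ L → Arrow n m k (suc L) →
                 (Fs : List (Subset n)) → Unique Fs → TracePFree _≼_ Fs →
                 length Fs ≤ m ∸ 1
proposition2p2 p _≼_ _ n m k L la arrow Fs unique-Fs Fs-free with m ≤? length Fs
... | no m≰|Fs| = ∸-monoˡ-≤ 1 (≰⇒> m≰|Fs|)
... | yes m≤|Fs| with arrow (take m Fs) (take⁺ m unique-Fs) (trans (length-take m Fs) (m≤n⇒m⊓n≡m m≤|Fs|))
... | X , refl , Gs , unique-Gs , |Gs|≡1+L , traces =
  ⊥-elim (<-irrefl refl (subst (_≤ L) |Gs|≡1+L |Gs|≤L))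
  where
  |Gs|≤L : length Gs ≤ L
  |Gs|≤L = trace-size-bound _≼_ X la (TracePFree-sub (lookup (take-⊆ m Fs)) Fs-free) Gs unique-Gs traces
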